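{- Let $\ell$ be prime and let $\lambda=(\lambda_1,\dots,\lambda_s)$ be an $\ell$-core partition of $n$ with abacus $(0,b_1,\dots,b_{\ell-1})$. If there exist $1\leq i<j\leq \ell-1$ with $b_j<b_i$, then the tuple obtained by swapping $b_i$ and $b_j$ is the abacus of an $\ell$-core partition $\lambda'$ of some integer $n'>n$.
   Context: A partition $\lambda$ is an $\ell$-core if none of its hook lengths $h_\lambda(k,j)=(\lambda_k-k)+(\lambda'_j-j)+1$ is a multiple of $\ell$. For $\lambda=(\lambda_1\geq\dots\geq\lambda_s>0)$ the structure numbers are $B_i:=\lambda_i-i+s$ ($1\le i\le s$). The abacus of an $\ell$-core $\lambda$ places a bead at position $B_i$ on rod $c\in\{0,\dots,\ell-1\}$ with $B_i\equiv c\pmod\ell$; for an $\ell$-core rod $0$ is empty and on each rod $c$ the beads occupy exactly the positions $c,c+\ell,\dots,c+(b_c-1)\ell$, where $b_c$ is the number of beads on rod $c$. Conversely, any tuple $(0,b_1,\dots,b_{\ell-1})$ of nonnegative integers determines such a set of bead positions $\{B_1>\dots>B_s\}$, $s=\sum b_c$, and hence the $\ell$-core partition with parts $B_i+i-s$. The abacus of $\lambda$ is recorded as $(0,b_1,\dots,b_{\ell-1})$. -}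

module Defs where

open import Data.Nat using (ℕ; suc; _+_; _∸_; _≤_; _≟_; _≤?_; NonZero)
open import Data.Nat.DivMod using (_%_)
open import Data.Nat.Divisibility using (_∣_)
open import Data.Fin using (Fin; toℕ)
import Data.Fin as F
open import Data.List using (List; length; lookup; filter; tabulate)
open import Data.List.Relation.Unary.All using (All)
open import Data.List.Relation.Unary.Linked using (Linked)
open import Data.Product using (_×_)
open import Relation.Nullary using (¬_; yes; no)
open import Relation.Binary.PropositionalEquality using (_≡_)

IsPartition : List ℕ → Set
IsPartition la = Linked (λ a b → b ≤ a) la × All (1 ≤_) la

conj : List ℕ → ℕ → ℕ
conj la j = length (filter (j ≤?_) la)

-- Hook length of the cell in row k+1, column j+1 (0-based Fin indices k, j):
-- h(k,j) = (λ_k - j) + (λ'_j - k) + 1  (1-based k, j), equal to (λ_k-k)+(λ'_j-j)+1.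
hook : (la : List ℕ) (k : Fin (length la)) → Fin (lookup la k) → ℕ
hook la k j = (lookup la k ∸ suc (toℕ j)) + (conj la (suc (toℕ j)) ∸ suc (toℕ k)) + 1

IsCore : ℕ → List ℕ → Set
IsCore ℓ la = (k : Fin (length la)) (j : Fin (lookup la k)) → ¬ (ℓ ∣ hook la k j)

structureNumbers : List ℕ → List ℕ
structureNumbers la = tabulate {n = length la} (λ k → (lookup la k + length la) ∸ suc (toℕ k))

abacus : (ℓ : ℕ) .{{_ : NonZero ℓ}} → List ℕ → Fin ℓ → ℕ
abacus ℓ la c = length (filter (λ B → B % ℓ ≟ toℕ c) (structureNumbers la))

swapAt : {ℓ : ℕ} → (Fin ℓ → ℕ) → Fin ℓ → Fin ℓ → Fin ℓ → ℕ
swapAt b i j c with c F.≟ i | c F.≟ j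
... | yes _ | _ = b j
... | no _ | yes _ = b i
... | no _ | no _ = b c

size : List ℕ → ℕ
size = Data.Nat.ListAction.sum
  where import Data.Nat.ListAction

{-# OPTIONS --safe #-}
-- Let λ have s parts and beta-numbers Bₖ = λₖ - k + s. The hook lengths in row k are
-- exactly the differences Bₖ - p with p < Bₖ not a beta-number. Hence λ is an ℓ-core iff
-- its beta-set is closed under x ↦ x - ℓ, i.e. iff on every rod of the ℓ-abacus the beads
-- fill the lowest positions; rod 0 is empty since Bₖ = Bₖ - 0 is itself a hook length.
-- Conversely any bead counts with rod 0 empty come from an ℓ-core, and |λ| = Σ Bₖ - s(s-1)/2.
-- Swapping bᵢ > bⱼ (i < j) keeps s and raises Σ Bₖ by (bᵢ - bⱼ)(j - i) > 0.
module Submission where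

open import Defs
open import Data.Empty using (⊥-elim)
open import Data.Fin using (Fin; toℕ; fromℕ<)
import Data.Fin as F
open import Data.Fin.Properties using (toℕ<n; toℕ-fromℕ<; toℕ-injective)
open import Data.List using (List; []; _∷_; length; lookup; filter; map; downFrom)
open import Data.List.Properties
  using (length-filter; filter-accept; filter-reject; filter-none; tabulate-cong;
         length-map; length-downFrom; map-∘; map-id-local)
open import Data.List.Relation.Unary.All as All using (All; []; _∷_)
open import Data.List.Relation.Unary.All.Properties using (all-filter)
open import Data.List.Relation.Unary.AllPairs as AllPairs using (AllPairs; []; _∷_)
open import Data.List.Relation.Unary.AllPairs.Properties as AllPairsₚ using (applyDownFrom⁺₁)
open import Data.List.Relation.Unary.Any using (here; there)
open import Data.List.Relation.Unary.Linked using (Linked; []; [-]; _∷_)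
open import Data.List.Relation.Unary.Linked.Properties using (Linked⇒AllPairs)
open import Data.List.Membership.Propositional using (_∈_; _∉_)
open import Data.List.Membership.Propositional.Properties
  using (∈-map⁺; ∈-map⁻; ∈-filter⁺; ∈-filter⁻; ∈-downFrom⁺; ∈-downFrom⁻)
open import Data.Nat
open import Data.Nat.DivMod
open import Data.Nat.Divisibility using (_∣_; divides; ∣-refl; n∣m*n; m%n≡0⇒n∣m)
open import Data.Nat.ListAction using (sum)
open import Data.Nat.Primality using (Prime)
open import Data.Nat.Properties
open import Data.List.Membership.DecPropositional _≟_ using (_∈?_)
open import Algebra.Properties.CommutativeSemigroup +-commutativeSemigroup using (x∙yz≈y∙xz)
open import Data.Nat.Tactic.RingSolver using (solve-∀)
open import Data.Product using (Σ; ∃-syntax; _×_; _,_; proj₁; proj₂)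
open import Function using (id)
open import Relation.Binary using (tri<; tri≈; tri>)
open import Relation.Binary.PropositionalEquality
open import Relation.Nullary using (Dec; yes; no; ¬_; contradiction)
open import Relation.Unary using (Decidable)
open import Relation.Unary.Properties using (∁?)

-- Lists of natural numbers

at : List ℕ → ℕ → ℕ
at []       _       = 0
at (x ∷ xs) zero    = x
at (x ∷ xs) (suc m) = at xs m

lookup≡at : ∀ xs (k : Fin (length xs)) → lookup xs k ≡ at xs (toℕ k)
lookup≡at (x ∷ xs) F.zero    = refl
lookup≡at (x ∷ xs) (F.suc k) = lookup≡at xs k

at-∈ : ∀ xs {m} → m < length xs → at xs m ∈ xs
at-∈ (x ∷ xs) {zero}  _          = here refl
at-∈ (x ∷ xs) {suc m} (s≤s m<n) = there (at-∈ xs m<n)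

∈⇒at : ∀ {x} xs → x ∈ xs → ∃[ m ] m < length xs × at xs m ≡ x
∈⇒at (y ∷ xs) (here refl) = 0 , s≤s z≤n , refl
∈⇒at (y ∷ xs) (there x∈) with ∈⇒at xs x∈
... | m , m<n , eq = suc m , s≤s m<n , eq

at-All : ∀ {P : ℕ → Set} {xs} → All P xs → ∀ {m} → m < length xs → P (at xs m)
at-All (px ∷ _)   {zero}  _          = px
at-All (_ ∷ pxs) {suc m} (s≤s m<n) = at-All pxs m<n

at-antitone : ∀ {xs} → AllPairs _≥_ xs → ∀ {m m′} → m ≤ m′ → m′ < length xs → at xs m′ ≤ at xs m
at-antitone (x≥ ∷ _)   {zero}  {zero}   _         _           = ≤-refl
at-antitone (x≥ ∷ _)   {zero}  {suc m′} _         (s≤s m′<n) = at-All x≥ m′<n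
at-antitone (_ ∷ ≥xs) {suc m} {suc m′} (s≤s m≤m′) (s≤s m′<n) = at-antitone ≥xs m≤m′ m′<n

-- On a decreasing list the entries ≥ t form a prefix, of length conj xs t.
conj-head-≤ : ∀ {x xs t} → t ≤ x → conj (x ∷ xs) t ≡ suc (conj xs t)
conj-head-≤ t≤x = cong length (filter-accept (_ ≤?_) t≤x)

conj-head-> : ∀ {x xs t} → x < t → conj (x ∷ xs) t ≡ conj xs t
conj-head-> x<t = cong length (filter-reject (_ ≤?_) (<⇒≱ x<t))

conj-all-< : ∀ {xs t} → All (_< t) xs → conj xs t ≡ 0
conj-all-< []           = refl
conj-all-< (x<t ∷ xs<t) = trans (conj-head-> x<t) (conj-all-< xs<t)

conj-<head : ∀ {x xs t} → AllPairs _≥_ (x ∷ xs) → x < t → conj (x ∷ xs) t ≡ 0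
conj-<head (x≥ ∷ _) x<t =
  trans (conj-head-> x<t) (conj-all-< (All.map (λ y≤x → ≤-<-trans y≤x x<t) x≥))

<conj⇒≤at : ∀ {xs} → AllPairs _≥_ xs → ∀ {t m} → m < conj xs t → t ≤ at xs m
<conj⇒≤at {x ∷ xs} ≥x∷xs@(_ ∷ ≥xs) {t} {m} m<c with t ≤? x
... | no t≰x with () ← subst (m <_) (conj-<head ≥x∷xs (≰⇒> t≰x)) m<c
... | yes t≤x with m | subst (m <_) (conj-head-≤ t≤x) m<c
...   | zero   | _         = t≤x
...   | suc m′ | s≤s m′<c = <conj⇒≤at ≥xs m′<c

conj≤⇒at< : ∀ {xs} → AllPairs _≥_ xs → ∀ {t m} → conj xs t ≤ m → m < length xs → at xs m < t
conj≤⇒at< {x ∷ xs} (x≥ ∷ ≥xs) {t} {m} c≤m m<n with t ≤? x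
... | yes t≤x with m | subst (_≤ m) (conj-head-≤ t≤x) c≤m | m<n
...   | suc m′ | s≤s c≤m′ | s≤s m′<n = conj≤⇒at< ≥xs c≤m′ m′<n
conj≤⇒at< {x ∷ xs} (x≥ ∷ ≥xs) {t} {zero}   c≤m m<n        | no t≰x = ≰⇒> t≰x
conj≤⇒at< {x ∷ xs} (x≥ ∷ ≥xs) {t} {suc m′} c≤m (s≤s m′<n) | no t≰x = ≤-<-trans (at-All x≥ m′<n) (≰⇒> t≰x)

conj-unique : ∀ {xs} → AllPairs _≥_ xs → ∀ {t c} → c ≤ length xs →
  (∀ {m} → m < c → t ≤ at xs m) → (∀ {m} → c ≤ m → m < length xs → at xs m < t) →
  c ≡ conj xs t
conj-unique {xs} ≥xs {t} {c} c≤n above below with <-cmp c (conj xs t)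
... | tri≈ _ c≡ _ = c≡
... | tri< c<conj _ _ =
  ⊥-elim (<⇒≱ (below ≤-refl (<-≤-trans c<conj (length-filter _ xs))) (<conj⇒≤at ≥xs c<conj))
... | tri> _ _ conj<c = ⊥-elim (<⇒≱ (conj≤⇒at< ≥xs ≤-refl (<-≤-trans conj<c c≤n)) (above conj<c))

∈-head-max : ∀ {z zs w} → All (z >_) zs → w ∈ z ∷ zs → w ≤ z
∈-head-max _   (here refl) = ≤-refl
∈-head-max z> (there w∈)  = <⇒≤ (All.lookup z> w∈)

decreasing-ext : ∀ {xs ys} → AllPairs _>_ xs → AllPairs _>_ ys →
  (∀ {z} → z ∈ xs → z ∈ ys) → (∀ {z} → z ∈ ys → z ∈ xs) → xs ≡ ys
decreasing-ext [] []      _ _ = refl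
decreasing-ext [] (_ ∷ _) _ ⊇ with () ← ⊇ (here refl)
decreasing-ext (_ ∷ _) [] ⊆ _ with () ← ⊆ (here refl)
decreasing-ext {x ∷ xs} {y ∷ ys} (x> ∷ >xs) (y> ∷ >ys) ⊆ ⊇ =
  cong₂ _∷_ x≡y (decreasing-ext >xs >ys (drop x> ⊆ x≡y) (drop y> ⊇ (sym x≡y)))
  where
  x≡y : x ≡ y
  x≡y = ≤-antisym (∈-head-max y> (⊆ (here refl))) (∈-head-max x> (⊇ (here refl)))
  drop : ∀ {u us v vs} → All (u >_) us → (∀ {z} → z ∈ u ∷ us → z ∈ v ∷ vs) → u ≡ v →
    ∀ {z} → z ∈ us → z ∈ vs
  drop u> ⊆′ u≡v z∈ with ⊆′ (there z∈)
  ... | here z≡v  = ⊥-elim (<-irrefl (trans z≡v (sym u≡v)) (All.lookup u> z∈))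
  ... | there z∈′ = z∈′

downFrom-decreasing : ∀ n → AllPairs _>_ (downFrom n)
downFrom-decreasing n = applyDownFrom⁺₁ id n (λ j<i _ → j<i)

downFrom-≤ : ∀ {n q} → All (q >_) (downFrom n) → n ≤ q
downFrom-≤ {zero}  _         = z≤n
downFrom-≤ {suc n} (n<q ∷ _) = n<q

head-≤-length : ∀ {q qs} → (∀ {r} → suc r ∈ q ∷ qs → r ∈ q ∷ qs) →
  qs ≡ downFrom (length qs) → q ≤ length qs
head-≤-length {zero}      _      _   = z≤n
head-≤-length {suc p} {qs} closed qs≡ with closed (here refl)
... | here p≡sp = ⊥-elim (1+n≢n (sym p≡sp))
... | there p∈  = ∈-downFrom⁻ (subst (p ∈_) qs≡ p∈)

pred-closed⇒downFrom : ∀ {qs} → AllPairs _>_ qs → (∀ {q} → suc q ∈ qs → q ∈ qs) →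
  qs ≡ downFrom (length qs)
pred-closed⇒downFrom []                   _      = refl
pred-closed⇒downFrom {q ∷ qs} (q> ∷ >qs) closed =
  cong₂ _∷_ (≤-antisym (head-≤-length closed qs≡) (downFrom-≤ (subst (All (q >_)) qs≡ q>))) qs≡
  where
  closed′ : ∀ {r} → suc r ∈ qs → r ∈ qs
  closed′ sr∈ with closed (there sr∈)
  ... | here refl = ⊥-elim (<-asym (n<1+n q) (All.lookup q> sr∈))
  ... | there r∈  = r∈
  qs≡ : qs ≡ downFrom (length qs)
  qs≡ = pred-closed⇒downFrom >qs closed′

module _ {P : ℕ → Set} (P? : Decidable P) where

  sum-filter-∁ : ∀ xs → sum xs ≡ sum (filter P? xs) + sum (filter (∁? P?) xs)
  sum-filter-∁ []       = refl
  sum-filter-∁ (x ∷ xs) with P? x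
  ... | yes _ = trans (cong (x +_) (sum-filter-∁ xs)) (sym (+-assoc x _ _))
  ... | no  _ = trans (cong (x +_) (sum-filter-∁ xs))
                      (x∙yz≈y∙xz x (sum (filter P? xs)) (sum (filter (∁? P?) xs)))

  length-filter-∁ : ∀ xs → length xs ≡ length (filter P? xs) + length (filter (∁? P?) xs)
  length-filter-∁ []       = refl
  length-filter-∁ (x ∷ xs) with P? x
  ... | yes _ = cong suc (length-filter-∁ xs)
  ... | no  _ = trans (cong suc (length-filter-∁ xs)) (sym (+-suc _ _))

module _ {P Q : ℕ → Set} (P? : Decidable P) (Q? : Decidable Q) where

  filter-filter-∁ : (∀ {x} → P x → ¬ Q x) → ∀ xs → filter P? (filter (∁? Q?) xs) ≡ filter P? xs
  filter-filter-∁ P⇒¬Q []       = refl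
  filter-filter-∁ P⇒¬Q (x ∷ xs) with Q? x
  ... | yes qx = trans (filter-filter-∁ P⇒¬Q xs) (sym (filter-reject P? (λ px → P⇒¬Q px qx)))
  ... | no  _ with P? x
  ...   | yes _ = cong (x ∷_) (filter-filter-∁ P⇒¬Q xs)
  ...   | no  _ = filter-filter-∁ P⇒¬Q xs

-- Beta-numbers

betas : List ℕ → List ℕ
betas []       = []
betas (a ∷ la) = a + length la ∷ betas la

structureNumbers≡betas : ∀ la → structureNumbers la ≡ betas la
structureNumbers≡betas []       = refl
structureNumbers≡betas (a ∷ la) = cong₂ _∷_ (cong pred (+-suc a (length la)))
  (trans (tabulate-cong (λ k → cong (_∸ suc (suc (toℕ k))) (+-suc (lookup la k) (length la))))
         (structureNumbers≡betas la))

length-betas : ∀ la → length (betas la) ≡ length la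
length-betas []       = refl
length-betas (a ∷ la) = cong suc (length-betas la)

at-betas : ∀ la {m} → m < length la → at la m + length la ≡ at (betas la) m + suc m
at-betas (a ∷ la) {zero}  _          = trans (+-suc a (length la)) (+-comm 1 (a + length la))
at-betas (a ∷ la) {suc m} (s≤s m<n) = begin
  at la m + suc (length la)   ≡⟨ +-suc (at la m) (length la) ⟩
  suc (at la m + length la)   ≡⟨ cong suc (at-betas la m<n) ⟩
  suc (at (betas la) m + suc m) ≡⟨ +-suc (at (betas la) m) (suc m) ⟨
  at (betas la) m + suc (suc m) ∎
  where open ≡-Reasoning

betas-< : ∀ {a} la → All (a ≥_) la → All (a + length la >_) (betas la)
betas-< []       []          = []
betas-< {a} (b ∷ la) (b≤a ∷ la≤a) =
  +-mono-≤-< b≤a (n<1+n (length la)) ∷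
  All.map (λ B< → <-≤-trans B< (+-monoʳ-≤ a (n≤1+n (length la)))) (betas-< la la≤a)

betas-decreasing : ∀ {la} → AllPairs _≥_ la → AllPairs _>_ (betas la)
betas-decreasing []                   = []
betas-decreasing {a ∷ la} (a≥ ∷ ≥la) = betas-< la a≥ ∷ betas-decreasing ≥la

betas-positive : ∀ {la} → All (1 ≤_) la → All (1 ≤_) (betas la)
betas-positive []                   = []
betas-positive {a ∷ la} (1≤a ∷ pos) = ≤-trans 1≤a (m≤m+n a (length la)) ∷ betas-positive pos

size-betas : ∀ la → size la + sum (downFrom (length la)) ≡ sum (betas la)
size-betas []       = refl
size-betas (a ∷ la) = begin
  a + size la + (length la + sum (downFrom (length la))) ≡⟨ shuffle a (size la) (length la) _ ⟩
  a + length la + (size la + sum (downFrom (length la))) ≡⟨ cong (a + length la +_) (size-betas la) ⟩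
  a + length la + sum (betas la)                          ∎
  where
  open ≡-Reasoning
  shuffle : ∀ a b n t → a + b + (n + t) ≡ a + n + (b + t)
  shuffle = solve-∀

fromBetas : List ℕ → List ℕ
fromBetas []       = []
fromBetas (B ∷ Bs) = B ∸ length Bs ∷ fromBetas Bs

length-fromBetas : ∀ Bs → length (fromBetas Bs) ≡ length Bs
length-fromBetas []       = refl
length-fromBetas (B ∷ Bs) = cong suc (length-fromBetas Bs)

length<head : ∀ {B Bs} → AllPairs _>_ (B ∷ Bs) → All (1 ≤_) (B ∷ Bs) → length Bs < B
length<head {Bs = []}    _                  (1≤B ∷ _) = 1≤B
length<head {Bs = C ∷ _} ((C<B ∷ _) ∷ >Cs) (_ ∷ pos) = <-≤-trans (s≤s (length<head >Cs pos)) C<B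

betas-fromBetas : ∀ {Bs} → AllPairs _>_ Bs → All (1 ≤_) Bs → betas (fromBetas Bs) ≡ Bs
betas-fromBetas []                   _ = refl
betas-fromBetas {B ∷ Bs} (B> ∷ >Bs) pos@(_ ∷ pos′) = cong₂ _∷_
  (trans (cong (B ∸ length Bs +_) (length-fromBetas Bs)) (m∸n+n≡m (<⇒≤ (length<head (B> ∷ >Bs) pos))))
  (betas-fromBetas >Bs pos′)

fromBetas-isPartition : ∀ {Bs} → AllPairs _>_ Bs → All (1 ≤_) Bs → IsPartition (fromBetas Bs)
fromBetas-isPartition >Bs pos = decreasing >Bs , positive >Bs pos
  where
  decreasing : ∀ {Bs} → AllPairs _>_ Bs → Linked (λ a b → b ≤ a) (fromBetas Bs)
  decreasing {[]}         _                  = []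
  decreasing {B ∷ []}     _                  = [-]
  decreasing {B ∷ C ∷ Cs} ((C<B ∷ _) ∷ >Cs) = ∸-monoˡ-≤ (suc (length Cs)) C<B ∷ decreasing >Cs
  positive : ∀ {Bs} → AllPairs _>_ Bs → All (1 ≤_) Bs → All (1 ≤_) (fromBetas Bs)
  positive []          []             = []
  positive (B> ∷ >Bs) pos@(_ ∷ pos′) = m<n⇒0<n∸m (length<head (B> ∷ >Bs) pos) ∷ positive >Bs pos′

∈-betas⇒row : ∀ {x} la → x ∈ betas la → ∃[ k ] k < length la × at (betas la) k ≡ x
∈-betas⇒row la x∈ with ∈⇒at (betas la) x∈
... | k , k<n , Bₖ≡x = k , subst (k <_) (length-betas la) k<n , Bₖ≡x

row⇒∈-betas : ∀ la {k} → k < length la → at (betas la) k ∈ betas la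
row⇒∈-betas la k<s = at-∈ (betas la) (subst (_ <_) (sym (length-betas la)) k<s)

-- Hook lengths through beta-numbers

hookAt : List ℕ → ℕ → ℕ → ℕ
hookAt la k j = (at la k ∸ suc j) + (conj la (suc j) ∸ suc k) + 1

hook≡hookAt : ∀ la (k : Fin (length la)) (j : Fin (lookup la k)) →
  hook la k j ≡ hookAt la (toℕ k) (toℕ j)
hook≡hookAt la k j =
  cong (λ x → (x ∸ suc (toℕ j)) + (conj la (suc (toℕ j)) ∸ suc (toℕ k)) + 1) (lookup≡at la k)

-- In the arithmetic below, row : x + s ≡ B + suc m relates the length x = λₘ of row m to
-- its beta-number B = Bₘ, and balance : p + c ≡ j + s pairs column j, of length
-- c = λ′ⱼ₊₁, with p = j + s - c.

hook-sum : ∀ {x s B k j c p} → j < x → k < c → x + s ≡ B + suc k → p + c ≡ j + s →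
  p + ((x ∸ suc j) + (c ∸ suc k) + 1) ≡ B
hook-sum {s = s} {B} {k} {j} {p = p} j<x k<c row balance with m≤n⇒∃[o]m+o≡n j<x | m≤n⇒∃[o]m+o≡n k<c
... | d , refl | e , refl = +-cancelʳ-≡ (suc k) _ _ (begin
  p + ((suc j + d ∸ suc j) + (suc k + e ∸ suc k) + 1) + suc k
    ≡⟨ cong₂ (λ u v → p + (u + v + 1) + suc k) (m+n∸m≡n (suc j) d) (m+n∸m≡n (suc k) e) ⟩
  p + (d + e + 1) + suc k    ≡⟨ shuffle p d e k ⟩
  p + (suc k + e) + suc d    ≡⟨ cong (_+ suc d) balance ⟩
  j + s + suc d              ≡⟨ shuffle′ j s d ⟩
  suc j + d + s              ≡⟨ row ⟩
  B + suc k                  ∎)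
  where
  open ≡-Reasoning
  shuffle : ∀ p d e k → p + (d + e + 1) + suc k ≡ p + (suc k + e) + suc d
  shuffle = solve-∀
  shuffle′ : ∀ j s d → j + s + suc d ≡ suc j + d + s
  shuffle′ = solve-∀

col<⇒gap< : ∀ {x s B m j c p} → m < c → j < x → x + s ≡ B + suc m → p + c ≡ j + s → p < B
col<⇒gap< {x} {s} {B} {m} {j} {c} {p} m<c j<x row balance = +-cancelʳ-≤ (suc m) (suc p) B (begin
  suc p + suc m ≤⟨ +-monoʳ-≤ (suc p) m<c ⟩
  suc p + c     ≡⟨ cong suc balance ⟩
  suc j + s     ≤⟨ +-monoˡ-≤ s j<x ⟩
  x + s         ≡⟨ row ⟩
  B + suc m     ∎)
  where open ≤-Reasoning

col≥⇒gap> : ∀ {x s B m j c p} → c ≤ m → x ≤ j → x + s ≡ B + suc m → p + c ≡ j + s → B < p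
col≥⇒gap> {x} {s} {B} {m} {j} {c} {p} c≤m x≤j row balance = +-cancelʳ-≤ m (suc B) p (begin
  suc B + m ≡⟨ +-suc B m ⟨
  B + suc m ≡⟨ row ⟨
  x + s     ≤⟨ +-monoˡ-≤ s x≤j ⟩
  j + s     ≡⟨ balance ⟨
  p + c     ≤⟨ +-monoʳ-≤ p c≤m ⟩
  p + m     ∎)
  where open ≤-Reasoning

gap<⇒col< : ∀ {x s B m j p} → p < B → x + s ≡ B + suc m → p + suc m ≡ j + s → j < x
gap<⇒col< {x} {s} {B} {m} {j} {p} p<B row balance = +-cancelʳ-≤ s (suc j) x (begin
  suc j + s     ≡⟨ cong suc balance ⟨
  suc p + suc m ≤⟨ +-monoˡ-≤ (suc m) p<B ⟩
  B + suc m     ≡⟨ row ⟨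
  x + s         ∎)
  where open ≤-Reasoning

gap>⇒col≥ : ∀ {x s B m j p} → B < p → x + s ≡ B + suc m → p + m ≡ j + s → x ≤ j
gap>⇒col≥ {x} {s} {B} {m} {j} {p} B<p row balance = +-cancelʳ-≤ s x j (begin
  x + s     ≡⟨ row ⟩
  B + suc m ≡⟨ +-suc B m ⟩
  suc B + m ≤⟨ +-monoˡ-≤ m B<p ⟩
  p + m     ≡⟨ balance ⟩
  j + s     ∎)
  where open ≤-Reasoning

gap>⇒length≤ : ∀ {x s B m p} → B < p → 1 ≤ x → x + s ≡ B + suc m → s ≤ p + m
gap>⇒length≤ {x} {s} {B} {m} {p} B<p 1≤x row = begin
  s         ≤⟨ m≤n+m s x ⟩
  x + s     ≡⟨ row ⟩
  B + suc m ≡⟨ +-suc B m ⟩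
  suc B + m ≤⟨ +-monoˡ-≤ m B<p ⟩
  p + m     ∎
  where open ≤-Reasoning

cell⇒gap : ∀ {la} → AllPairs _≥_ la → ∀ {k j} → k < length la → j < at la k →
  ∃[ p ] p + hookAt la k j ≡ at (betas la) k × p ∉ betas la
cell⇒gap {la} ≥la {k} {j} k<s j<λₖ = j + (s ∸ c) , hook-sum j<λₖ k<c (at-betas la k<s) balance , p∉
  where
  s c : ℕ
  s = length la
  c = conj la (suc j)
  balance : j + (s ∸ c) + c ≡ j + s
  balance = trans (+-assoc j _ c) (cong (j +_) (m∸n+n≡m (length-filter _ la)))
  short-below : ∀ {m} → c ≤ m → m < s → at la m ≤ j
  short-below c≤m m<s = s≤s⁻¹ (conj≤⇒at< ≥la c≤m m<s)
  k<c : k < c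
  k<c with k <? c
  ... | yes k<c = k<c
  ... | no  k≮c = ⊥-elim (<⇒≱ j<λₖ (short-below (≮⇒≥ k≮c) k<s))
  p∉ : j + (s ∸ c) ∉ betas la
  p∉ p∈ with ∈-betas⇒row la p∈
  ... | m , m<s , Bₘ≡p with m <? c
  ...   | yes m<c =
    <-irrefl (sym Bₘ≡p) (col<⇒gap< m<c (<conj⇒≤at ≥la m<c) (at-betas la m<s) balance)
  ...   | no m≮c =
    <-irrefl Bₘ≡p (col≥⇒gap> (≮⇒≥ m≮c) (short-below (≮⇒≥ m≮c) m<s) (at-betas la m<s) balance)

gap-column : ∀ {la} → AllPairs _≥_ la → All (1 ≤_) la → ∀ {p c′} → suc c′ ≤ length la →
  (∀ {m} → m ≤ c′ → p < at (betas la) m) →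
  (∀ {m} → c′ < m → m < length la → at (betas la) m < p) →
  ∃[ j ] p + suc c′ ≡ j + length la × suc c′ ≡ conj la (suc j)
gap-column {la} ≥la pos {p} {c′} c≤s above below =
  j , balance , conj-unique ≥la c≤s long short
  where
  s c : ℕ
  s = length la
  c = suc c′
  s≤p+c : s ≤ p + c
  s≤p+c with c ≟ s
  ... | yes c≡s = subst (_≤ p + c) c≡s (m≤n+m c p)
  ... | no  c≢s = gap>⇒length≤ (below ≤-refl c<s) (at-All pos c<s) (at-betas la c<s)
    where c<s = ≤∧≢⇒< c≤s c≢s
  j : ℕ
  j = p + c ∸ s
  balance : p + c ≡ j + s
  balance = sym (m∸n+n≡m s≤p+c)
  long : ∀ {m} → m < c → suc j ≤ at la m
  long m<c = ≤-trans (gap<⇒col< (above ≤-refl) (at-betas la c≤s) balance)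
                     (at-antitone ≥la (s≤s⁻¹ m<c) c≤s)
  short : ∀ {m} → c ≤ m → m < s → at la m < suc j
  short c≤m m<s = s≤s (≤-trans (at-antitone ≥la c≤m m<s)
                               (gap>⇒col≥ (below ≤-refl c<s) (at-betas la c<s) balance))
    where c<s = ≤-<-trans c≤m m<s

gap⇒cell : ∀ {la} → AllPairs _≥_ la → All (1 ≤_) la → ∀ {k p} → k < length la →
  p < at (betas la) k → p ∉ betas la →
  ∃[ j ] j < at la k × p + hookAt la k j ≡ at (betas la) k
gap⇒cell {la} ≥la pos {k} {p} k<s p<Bₖ p∉ = column k<c c≤s above below
  where
  S : List ℕ
  S = betas la
  ≥S : AllPairs _≥_ S
  ≥S = AllPairs.map <⇒≤ (betas-decreasing ≥la)
  c : ℕ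
  c = conj S (suc p)
  c≤s : c ≤ length la
  c≤s = subst (c ≤_) (length-betas la) (length-filter _ S)
  above : ∀ {m} → m < c → p < at S m
  above = <conj⇒≤at ≥S
  below : ∀ {m} → c ≤ m → m < length la → at S m < p
  below c≤m m<s = ≤∧≢⇒< (s≤s⁻¹ (conj≤⇒at< ≥S c≤m m<n))
                        (λ Bₘ≡p → p∉ (subst (_∈ S) Bₘ≡p (row⇒∈-betas la m<s)))
    where m<n = subst (_ <_) (sym (length-betas la)) m<s
  k<c : k < c
  k<c with k <? c
  ... | yes k<c = k<c
  ... | no  k≮c = ⊥-elim (<-asym p<Bₖ (below (≮⇒≥ k≮c) k<s))
  column : ∀ {c} → k < c → c ≤ length la → (∀ {m} → m < c → p < at S m) →
    (∀ {m} → c ≤ m → m < length la → at S m < p) →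
    ∃[ j ] j < at la k × p + hookAt la k j ≡ at S k
  column {suc c′} k<c c≤s above below
    with j , balance , c≡conj ← gap-column ≥la pos c≤s (λ m≤c′ → above (s≤s m≤c′)) below
    = j , j<λₖ , subst (λ c → p + ((at la k ∸ suc j) + (c ∸ suc k) + 1) ≡ at S k) c≡conj
                   (hook-sum j<λₖ k<c (at-betas la k<s) balance)
    where j<λₖ = <conj⇒≤at ≥la (subst (k <_) c≡conj k<c)

-- ℓ-cores

partition-decreasing : ∀ {la} → IsPartition la → AllPairs _≥_ la
partition-decreasing (linked , _) = Linked⇒AllPairs (λ b≤a c≤b → ≤-trans c≤b b≤a) linked

IsCoreAt : ℕ → List ℕ → Set
IsCoreAt ℓ la = ∀ {k j} → k < length la → j < at la k → ¬ ℓ ∣ hookAt la k j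

IsCore⇒IsCoreAt : ∀ {ℓ la} → IsCore ℓ la → IsCoreAt ℓ la
IsCore⇒IsCoreAt {ℓ} {la} core {k} {j} k<s j<λₖ ℓ∣h = core kᶠ jᶠ (subst (ℓ ∣_) (sym hook≡) ℓ∣h)
  where
  kᶠ : Fin (length la)
  kᶠ = fromℕ< k<s
  toℕ-kᶠ : toℕ kᶠ ≡ k
  toℕ-kᶠ = toℕ-fromℕ< k<s
  j<λ : j < lookup la kᶠ
  j<λ = subst (j <_) (sym (trans (lookup≡at la kᶠ) (cong (at la) toℕ-kᶠ))) j<λₖ
  jᶠ : Fin (lookup la kᶠ)
  jᶠ = fromℕ< j<λ
  hook≡ : hook la kᶠ jᶠ ≡ hookAt la k j
  hook≡ = trans (hook≡hookAt la kᶠ jᶠ) (cong₂ (hookAt la) toℕ-kᶠ (toℕ-fromℕ< j<λ))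

IsCoreAt⇒IsCore : ∀ {ℓ la} → IsCoreAt ℓ la → IsCore ℓ la
IsCoreAt⇒IsCore {ℓ} {la} core k j ℓ∣h =
  core (toℕ<n k) (subst (toℕ j <_) (lookup≡at la k) (toℕ<n j))
       (subst (ℓ ∣_) (hook≡hookAt la k j) ℓ∣h)

module _ {ℓ la} (isP : IsPartition la) (isCore : IsCore ℓ la) where

  private
    ≥la : AllPairs _≥_ la
    ≥la = partition-decreasing isP
    pos : All (1 ≤_) la
    pos = proj₂ isP
    S : List ℕ
    S = betas la
    core : IsCoreAt ℓ la
    core = IsCore⇒IsCoreAt {ℓ} {la} isCore
    0∉S : 0 ∉ S
    0∉S 0∈ = <-irrefl refl (All.lookup (betas-positive pos) 0∈)
    ∉-≢ : ∀ {x y} → x ∈ S → y ∉ S → y ≢ x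
    ∉-≢ x∈ y∉ y≡x = y∉ (subst (_∈ S) (sym y≡x) x∈)
    positive : ∀ {k} → k < length la → 0 < at S k
    positive k<s = at-All (betas-positive pos) (subst (_ <_) (sym (length-betas la)) k<s)

  core⇒betas-∤ : ∀ {x} → x ∈ S → ¬ ℓ ∣ x
  core⇒betas-∤ x∈ ℓ∣x with k , k<s , refl ← ∈-betas⇒row la x∈
    with j , j<λₖ , h≡Bₖ ← gap⇒cell ≥la pos k<s (positive k<s) 0∉S
    = core k<s j<λₖ (subst (ℓ ∣_) (sym h≡Bₖ) ℓ∣x)

  core⇒betas-closed : ∀ {x} → x ∈ S → ℓ ≤ x → x ∸ ℓ ∈ S
  core⇒betas-closed {x} x∈ ℓ≤x with x ∸ ℓ ∈? S
  ... | yes p∈ = p∈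
  ... | no  p∉ with k , k<s , refl ← ∈-betas⇒row la x∈
    with j , j<λₖ , p+h≡x ← gap⇒cell ≥la pos k<s (≤∧≢⇒< (m∸n≤m x ℓ) (∉-≢ x∈ p∉)) p∉
    = ⊥-elim (core k<s j<λₖ (subst (ℓ ∣_) h≡ℓ ∣-refl))
    where
    h≡ℓ : ℓ ≡ hookAt la k j
    h≡ℓ = +-cancelˡ-≡ (x ∸ ℓ) _ _ (trans (trans (+-comm (x ∸ ℓ) ℓ) (m+[n∸m]≡n ℓ≤x)) (sym p+h≡x))

residue-closed⇒core : ∀ {ℓ} .{{_ : NonZero ℓ}} {Bs} → AllPairs _>_ Bs → All (1 ≤_) Bs →
  (∀ {x y} → x ∈ Bs → y ≤ x → y % ℓ ≡ x % ℓ → y ∈ Bs) → IsCoreAt ℓ (fromBetas Bs)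
residue-closed⇒core {ℓ} {Bs} >Bs pos closed {k} k<s j<λₖ (divides q h≡qℓ)
  with p , p+h≡B , p∉ ← cell⇒gap (partition-decreasing (fromBetas-isPartition >Bs pos)) k<s j<λₖ
  = p∉ (subst (p ∈_) (sym betas≡) (closed B∈ (subst (p ≤_) p+h≡B (m≤m+n p _)) residue))
  where
  betas≡ : betas (fromBetas Bs) ≡ Bs
  betas≡ = betas-fromBetas >Bs pos
  B : ℕ
  B = at (betas (fromBetas Bs)) k
  B∈ : B ∈ Bs
  B∈ = subst (B ∈_) betas≡ (row⇒∈-betas (fromBetas Bs) k<s)
  residue : p % ℓ ≡ B % ℓ
  residue = sym (trans (cong (_% ℓ) (trans (sym p+h≡B) (cong (p +_) h≡qℓ))) ([m+kn]%n≡m%n p q ℓ))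

-- The ℓ-abacus

module _ {ℓ : ℕ} .{{_ : NonZero ℓ}} where

  OnRod : Fin ℓ → ℕ → Set
  OnRod c x = x % ℓ ≡ toℕ c

  rod? : ∀ c x → Dec (OnRod c x)
  rod? c x = x % ℓ ≟ toℕ c

  rod : Fin ℓ → List ℕ → List ℕ
  rod c = filter (rod? c)

  OnRod⇒mod : ∀ {c x} → OnRod c x → x mod ℓ ≡ c
  OnRod⇒mod x%≡ = toℕ-injective (trans (toℕ-fromℕ< _) x%≡)

  mod⇒OnRod : ∀ {c x} → x mod ℓ ≡ c → OnRod c x
  mod⇒OnRod refl = sym (toℕ-fromℕ< _)

  OnRod-mod : ∀ x → OnRod (x mod ℓ) x
  OnRod-mod x = mod⇒OnRod refl

  OnRod-decompose : ∀ {c x} → OnRod c x → toℕ c + x / ℓ * ℓ ≡ x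
  OnRod-decompose {x = x} x%≡ = sym (trans (m≡m%n+[m/n]*n x ℓ) (cong (_+ x / ℓ * ℓ) x%≡))

  OnRod-/-< : ∀ {c x y} → OnRod c x → OnRod c y → y < x → y / ℓ < x / ℓ
  OnRod-/-< {c} x%≡ y%≡ y<x = ≤∧≢⇒< (/-monoˡ-≤ ℓ (<⇒≤ y<x)) (λ y/≡x/ → <-irrefl (begin
    _                   ≡⟨ OnRod-decompose y%≡ ⟨
    toℕ c + _ / ℓ * ℓ   ≡⟨ cong (λ q → toℕ c + q * ℓ) y/≡x/ ⟩
    toℕ c + _ / ℓ * ℓ   ≡⟨ OnRod-decompose x%≡ ⟩
    _                   ∎) y<x)
    where open ≡-Reasoning

  runner : Fin ℓ → ℕ → List ℕ
  runner c n = map (λ q → toℕ c + q * ℓ) (downFrom n)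

  runner-% : ∀ c q → (toℕ c + q * ℓ) % ℓ ≡ toℕ c
  runner-% c q = trans ([m+kn]%n≡m%n (toℕ c) q ℓ) (m<n⇒m%n≡m (toℕ<n c))

  runner-/ : ∀ c q → (toℕ c + q * ℓ) / ℓ ≡ q
  runner-/ c q = trans (+-distrib-/-∣ʳ (toℕ c) (n∣m*n q)) (cong₂ _+_ (m<n⇒m/n≡0 (toℕ<n c)) (m*n/n≡m q ℓ))

  ∈-runner⁻ : ∀ {c n x} → x ∈ runner c n → OnRod c x × x / ℓ < n
  ∈-runner⁻ {c} {n} x∈ with q , q∈ , refl ← ∈-map⁻ _ x∈ =
    runner-% c q , subst (_< n) (sym (runner-/ c q)) (∈-downFrom⁻ q∈)

  ∈-runner⁺ : ∀ {c n x} → OnRod c x → x / ℓ < n → x ∈ runner c n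
  ∈-runner⁺ {c} {n} {x} x%≡ x/<n = subst (_∈ runner c n) (OnRod-decompose x%≡) (∈-map⁺ _ (∈-downFrom⁺ x/<n))

  runner-decreasing : ∀ c n → AllPairs _>_ (runner c n)
  runner-decreasing c n = AllPairsₚ.map⁺ (applyDownFrom⁺₁ id n (λ j<i _ → +-monoʳ-< (toℕ c) (*-monoˡ-< ℓ j<i)))

  length-runner : ∀ c n → length (runner c n) ≡ n
  length-runner c n = trans (length-map _ (downFrom n)) (length-downFrom n)

  sum-runner : ∀ c n → sum (runner c n) ≡ n * toℕ c + sum (downFrom n) * ℓ
  sum-runner c zero    = refl
  sum-runner c (suc n) =
    trans (cong (toℕ c + n * ℓ +_) (sum-runner c n)) (regroup (toℕ c) n ℓ (sum (downFrom n)))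
    where
    regroup : ∀ c n ℓ t → c + n * ℓ + (n * c + t * ℓ) ≡ suc n * c + (n + t) * ℓ
    regroup = solve-∀

  -- Position x = c + qℓ is level q of rod c; the abacus b fills the levels below b c.
  Bead : (Fin ℓ → ℕ) → ℕ → Set
  Bead b x = x / ℓ < b (x mod ℓ)

  record BeadList (b : Fin ℓ → ℕ) (X : List ℕ) : Set where
    field
      decreasing : AllPairs _>_ X
      bead⁻      : ∀ {x} → x ∈ X → Bead b x
      bead⁺      : ∀ {x} → Bead b x → x ∈ X

  module _ {b X} (bl : BeadList b X) where
    open BeadList bl

    rod-BeadList : ∀ c → rod c X ≡ runner c (b c)
    rod-BeadList c = decreasing-ext (AllPairsₚ.filter⁺ _ decreasing) (runner-decreasing c (b c)) ⊆ ⊇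
      where
      ⊆ : ∀ {x} → x ∈ rod c X → x ∈ runner c (b c)
      ⊆ x∈ with x∈X , x%≡ ← ∈-filter⁻ _ x∈ =
        ∈-runner⁺ x%≡ (subst (λ d → _ < b d) (OnRod⇒mod x%≡) (bead⁻ x∈X))
      ⊇ : ∀ {x} → x ∈ runner c (b c) → x ∈ rod c X
      ⊇ x∈ with x%≡ , x/< ← ∈-runner⁻ x∈ =
        ∈-filter⁺ _ (bead⁺ (subst (λ d → _ < b d) (sym (OnRod⇒mod x%≡)) x/<)) x%≡

    length-rod-BeadList : ∀ c → length (rod c X) ≡ b c
    length-rod-BeadList c = trans (cong length (rod-BeadList c)) (length-runner c (b c))

    BeadList-residue-closed : ∀ {x y} → x ∈ X → y ≤ x → y % ℓ ≡ x % ℓ → y ∈ X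
    BeadList-residue-closed {x} {y} x∈ y≤x y%≡ =
      bead⁺ (≤-<-trans (/-monoˡ-≤ ℓ y≤x)
        (subst (λ d → x / ℓ < b d) (sym (OnRod⇒mod (trans y%≡ (OnRod-mod x)))) (bead⁻ x∈)))

  BeadList-cong : ∀ {b b′ X} → (∀ c → b c ≡ b′ c) → BeadList b X → BeadList b′ X
  BeadList-cong b≗b′ bl = record
    { decreasing = BeadList.decreasing bl
    ; bead⁻      = λ {x} x∈ → subst (x / ℓ <_) (b≗b′ (x mod ℓ)) (BeadList.bead⁻ bl x∈)
    ; bead⁺      = λ {x} bead → BeadList.bead⁺ bl (subst (x / ℓ <_) (sym (b≗b′ (x mod ℓ))) bead)
    }

  BeadList-positive : ∀ {b X} → BeadList b X → (∀ c → toℕ c ≡ 0 → b c ≡ 0) → All (1 ≤_) X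
  BeadList-positive bl rod₀-empty = All.tabulate positive
    where
    positive : ∀ {x} → x ∈ _ → 1 ≤ x
    positive {zero}  0∈ = contradiction (BeadList.bead⁻ bl 0∈)
      (subst (λ n → ¬ 0 / ℓ < n) (sym (rod₀-empty _ (trans (toℕ-fromℕ< _) (n≤0⇒n≡0 (m%n≤m 0 ℓ))))) (λ ()))
    positive {suc x} _  = s≤s z≤n

  bead? : ∀ b x → Dec (Bead b x)
  bead? b x = x / ℓ <? b (x mod ℓ)

  beads : ℕ → (Fin ℓ → ℕ) → List ℕ
  beads M b = filter (bead? b) (downFrom (M * ℓ))

  beads-BeadList : ∀ {M b} → (∀ c → b c ≤ M) → BeadList b (beads M b)
  beads-BeadList {M} {b} b≤M = record
    { decreasing = AllPairsₚ.filter⁺ _ (downFrom-decreasing (M * ℓ))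
    ; bead⁻      = λ x∈ → proj₂ (∈-filter⁻ (bead? b) {xs = downFrom (M * ℓ)} x∈)
    ; bead⁺      = λ bead → ∈-filter⁺ (bead? b) (∈-downFrom⁺ (bounded bead)) bead
    }
    where
    open ≤-Reasoning
    bounded : ∀ {x} → Bead b x → x < M * ℓ
    bounded {x} bead = begin-strict
      x                   ≡⟨ m≡m%n+[m/n]*n x ℓ ⟩
      x % ℓ + x / ℓ * ℓ   <⟨ +-monoˡ-< (x / ℓ * ℓ) (m%n<n x ℓ) ⟩
      suc (x / ℓ) * ℓ     ≤⟨ *-monoˡ-≤ ℓ (≤-trans bead (b≤M (x mod ℓ))) ⟩
      M * ℓ               ∎

  rod-quotients-decreasing : ∀ {c R} → AllPairs _>_ R → All (OnRod c) R → AllPairs (λ x y → x / ℓ > y / ℓ) R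
  rod-quotients-decreasing []          []          = []
  rod-quotients-decreasing (x> ∷ >R) (x% ∷ R%) =
    All.zipWith (λ (y<x , y%) → OnRod-/-< x% y% y<x) (x> , R%) ∷ rod-quotients-decreasing >R R%

  module _ {X} (>X : AllPairs _>_ X) (closed : ∀ {x} → x ∈ X → ℓ ≤ x → x ∸ ℓ ∈ X) where

    -- The quotients x / ℓ of the beads on a rod form a predecessor-closed set.
    closed⇒rod≡runner : ∀ c → rod c X ≡ runner c (length (rod c X))
    closed⇒rod≡runner c = begin
      R                                  ≡⟨ map-id-local (All.map OnRod-decompose (all-filter (rod? c) X)) ⟨
      map (λ x → toℕ c + x / ℓ * ℓ) R    ≡⟨ map-∘ R ⟩
      map (λ q → toℕ c + q * ℓ) Q        ≡⟨ cong (map _) (pred-closed⇒downFrom Q-decreasing Q-closed) ⟩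
      runner c (length Q)                ≡⟨ cong (runner c) (length-map _ R) ⟩
      runner c (length R)                ∎
      where
      open ≡-Reasoning
      R Q : List ℕ
      R = rod c X
      Q = map (_/ ℓ) R
      Q-decreasing : AllPairs _>_ Q
      Q-decreasing = AllPairsₚ.map⁺
        (rod-quotients-decreasing (AllPairsₚ.filter⁺ (rod? c) >X) (all-filter (rod? c) X))
      lower : ∀ {x q} → x ∈ R → suc q ≡ x / ℓ → q ∈ Q
      lower {x} x∈R sq≡ = subst (_∈ Q) (trans ([m∸n]/n≡m/n∸1 x ℓ) (cong pred (sym sq≡)))
        (∈-map⁺ _ (∈-filter⁺ (rod? c) (closed x∈X ℓ≤x) (trans (m≤n⇒[n∸m]%m≡n%m ℓ≤x) x%≡)))
        where
        x∈X : x ∈ X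
        x∈X = proj₁ (∈-filter⁻ (rod? c) {xs = X} x∈R)
        x%≡ : OnRod c x
        x%≡ = proj₂ (∈-filter⁻ (rod? c) {xs = X} x∈R)
        ℓ≤x : ℓ ≤ x
        ℓ≤x = m/n≢0⇒n≤m (λ x/≡0 → 1+n≢0 (trans sq≡ x/≡0))
      Q-closed : ∀ {q} → suc q ∈ Q → q ∈ Q
      Q-closed sq∈ with x , x∈R , sq≡ ← ∈-map⁻ _ sq∈ = lower x∈R sq≡

    closed⇒BeadList : BeadList (λ c → length (rod c X)) X
    closed⇒BeadList = record { decreasing = >X ; bead⁻ = bead⁻ ; bead⁺ = bead⁺ }
      where
      bead⁻ : ∀ {x} → x ∈ X → Bead (λ c → length (rod c X)) x
      bead⁻ {x} x∈ = proj₂ (∈-runner⁻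
        (subst (x ∈_) (closed⇒rod≡runner (x mod ℓ)) (∈-filter⁺ (rod? _) x∈ (OnRod-mod x))))
      bead⁺ : ∀ {x} → Bead (λ c → length (rod c X)) x → x ∈ X
      bead⁺ {x} bead = proj₁ (∈-filter⁻ (rod? _) {xs = X}
        (subst (x ∈_) (sym (closed⇒rod≡runner (x mod ℓ))) (∈-runner⁺ (OnRod-mod x) bead)))

  others : Fin ℓ → Fin ℓ → List ℕ → List ℕ
  others i j X = filter (∁? (rod? j)) (filter (∁? (rod? i)) X)

  rod-∁ : ∀ {i j} → i ≢ j → ∀ X → rod j (filter (∁? (rod? i)) X) ≡ rod j X
  rod-∁ i≢j = filter-filter-∁ (rod? _) (rod? _) (λ x∈j x∈i → i≢j (toℕ-injective (trans (sym x∈i) x∈j)))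

  sum-rods : ∀ {i j} → i ≢ j → ∀ X → sum X ≡ sum (rod i X) + (sum (rod j X) + sum (others i j X))
  sum-rods {i} {j} i≢j X = begin
    sum X                                          ≡⟨ sum-filter-∁ (rod? i) X ⟩
    sum (rod i X) + sum X′                         ≡⟨ cong (sum (rod i X) +_) (sum-filter-∁ (rod? j) X′) ⟩
    sum (rod i X) + (sum (rod j X′) + sum (others i j X))
      ≡⟨ cong (λ Y → sum (rod i X) + (sum Y + sum (others i j X))) (rod-∁ i≢j X) ⟩
    sum (rod i X) + (sum (rod j X) + sum (others i j X)) ∎
    where
    open ≡-Reasoning
    X′ : List ℕ
    X′ = filter (∁? (rod? i)) X

  length-rods : ∀ {i j} → i ≢ j → ∀ X →
    length X ≡ length (rod i X) + (length (rod j X) + length (others i j X))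
  length-rods {i} {j} i≢j X = begin
    length X                                       ≡⟨ length-filter-∁ (rod? i) X ⟩
    length (rod i X) + length X′                   ≡⟨ cong (length (rod i X) +_) (length-filter-∁ (rod? j) X′) ⟩
    length (rod i X) + (length (rod j X′) + length (others i j X))
      ≡⟨ cong (λ Y → length (rod i X) + (length Y + length (others i j X))) (rod-∁ i≢j X) ⟩
    length (rod i X) + (length (rod j X) + length (others i j X)) ∎
    where
    open ≡-Reasoning
    X′ : List ℕ
    X′ = filter (∁? (rod? i)) X

  others-⊆ : ∀ {i j b b′ X Y} → BeadList b X → BeadList b′ Y → (∀ c → c ≢ i → c ≢ j → b c ≡ b′ c) →
    ∀ {x} → x ∈ others i j X → x ∈ others i j Y
  others-⊆ {i} {j} {b′ = b′} {X} bl bl′ agree {x} x∈ =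
    ∈-filter⁺ (∁? (rod? j)) (∈-filter⁺ (∁? (rod? i)) (BeadList.bead⁺ bl′ bead′) x∉i) x∉j
    where
    x∈X′ : x ∈ filter (∁? (rod? i)) X
    x∈X′ = proj₁ (∈-filter⁻ (∁? (rod? j)) {xs = filter (∁? (rod? i)) X} x∈)
    x∉j : ¬ OnRod j x
    x∉j = proj₂ (∈-filter⁻ (∁? (rod? j)) {xs = filter (∁? (rod? i)) X} x∈)
    x∈X : x ∈ X
    x∈X = proj₁ (∈-filter⁻ (∁? (rod? i)) {xs = X} x∈X′)
    x∉i : ¬ OnRod i x
    x∉i = proj₂ (∈-filter⁻ (∁? (rod? i)) {xs = X} x∈X′)
    bead′ : Bead b′ x
    bead′ = subst (x / ℓ <_)
      (agree (x mod ℓ) (λ x≡i → x∉i (mod⇒OnRod x≡i)) (λ x≡j → x∉j (mod⇒OnRod x≡j)))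
      (BeadList.bead⁻ bl x∈X)

  others-≡ : ∀ {i j b b′ X Y} → BeadList b X → BeadList b′ Y → (∀ c → c ≢ i → c ≢ j → b c ≡ b′ c) →
    others i j X ≡ others i j Y
  others-≡ {i} {j} bl bl′ agree = decreasing-ext (decreasing-others bl) (decreasing-others bl′)
    (others-⊆ bl bl′ agree) (others-⊆ bl′ bl (λ c c≢i c≢j → sym (agree c c≢i c≢j)))
    where
    decreasing-others : ∀ {b X} → BeadList b X → AllPairs _>_ (others i j X)
    decreasing-others bl = AllPairsₚ.filter⁺ _ (AllPairsₚ.filter⁺ _ (BeadList.decreasing bl))

  module _ {i j : Fin ℓ} (i≢j : i ≢ j) {b X} (bl : BeadList b X) where

    length-BeadList : length X ≡ b i + (b j + length (others i j X))
    length-BeadList = trans (length-rods i≢j X)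
      (cong₂ (λ u v → u + (v + length (others i j X))) (length-rod-BeadList bl i) (length-rod-BeadList bl j))

    sum-BeadList : sum X ≡ sum (runner i (b i)) + (sum (runner j (b j)) + sum (others i j X))
    sum-BeadList = trans (sum-rods i≢j X)
      (cong₂ (λ u v → sum u + (sum v + sum (others i j X))) (rod-BeadList bl i) (rod-BeadList bl j))

-- Swapping two rods

swapAt-i : ∀ {ℓ} (b : Fin ℓ → ℕ) i j → swapAt b i j i ≡ b j
swapAt-i b i j with i F.≟ i
... | yes _  = refl
... | no i≢i = ⊥-elim (i≢i refl)

swapAt-j : ∀ {ℓ} (b : Fin ℓ → ℕ) {i j} → i ≢ j → swapAt b i j j ≡ b i
swapAt-j b {i} {j} i≢j with j F.≟ i | j F.≟ j
... | yes j≡i | _      = ⊥-elim (i≢j (sym j≡i))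
... | no _    | yes _  = refl
... | no _    | no j≢j = ⊥-elim (j≢j refl)

swapAt-other : ∀ {ℓ} (b : Fin ℓ → ℕ) {i j} c → c ≢ i → c ≢ j → swapAt b i j c ≡ b c
swapAt-other b {i} {j} c c≢i c≢j with c F.≟ i | c F.≟ j
... | yes c≡i | _       = ⊥-elim (c≢i c≡i)
... | no _    | yes c≡j = ⊥-elim (c≢j c≡j)
... | no _    | no _    = refl

swapAt-≤ : ∀ {ℓ M} {b : Fin ℓ → ℕ} → (∀ c → b c ≤ M) → ∀ i j c → swapAt b i j c ≤ M
swapAt-≤ b≤M i j c with c F.≟ i | c F.≟ j
... | yes _ | _     = b≤M j
... | no _  | yes _ = b≤M i
... | no _  | no _  = b≤M c

rearrangement-< : ∀ {a A I J} → A < a → I < J → ∀ t T o →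
  a * I + t + (A * J + T + o) < A * I + T + (a * J + t + o)
rearrangement-< {A = A} {I} A<a I<J t T o with m≤n⇒∃[o]m+o≡n A<a | m≤n⇒∃[o]m+o≡n I<J
... | d , refl | e , refl = subst (lhs <_) (sym (expand A d I e t T o)) (m<m+n lhs z<s)
  where
  lhs : ℕ
  lhs = (suc A + d) * I + t + (A * (suc I + e) + T + o)
  expand : ∀ A d I e t T o → A * I + T + ((suc A + d) * (suc I + e) + t + o)
                             ≡ (suc A + d) * I + t + (A * (suc I + e) + T + o) + suc (e + d * suc e)
  expand = solve-∀

runner-sums-swap-< : ∀ {ℓ} .{{_ : NonZero ℓ}} {i j : Fin ℓ} {u v} → toℕ i < toℕ j → v < u → ∀ o →
  sum (runner i u) + (sum (runner j v) + o) < sum (runner i v) + (sum (runner j u) + o)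
runner-sums-swap-< {ℓ} {i} {j} {u} {v} i<j v<u o = subst₂ _<_
  (sym (cong₂ (λ x y → x + (y + o)) (sum-runner i u) (sum-runner j v)))
  (sym (cong₂ (λ x y → x + (y + o)) (sum-runner i v) (sum-runner j u)))
  (rearrangement-< v<u i<j (T u) (T v) o)
  where
  T : ℕ → ℕ
  T n = sum (downFrom n) * ℓ

module _ {ℓ : ℕ} .{{_ : NonZero ℓ}} {b : Fin ℓ → ℕ} {i j : Fin ℓ} {X Y : List ℕ}
         (bl : BeadList b X) (bl′ : BeadList (swapAt b i j) Y) (i<j : toℕ i < toℕ j) where

  private
    i≢j : i ≢ j
    i≢j i≡j = <-irrefl (cong toℕ i≡j) i<j
    swapped : ∀ (f : ℕ → ℕ → List ℕ → ℕ) →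
      f (swapAt b i j i) (swapAt b i j j) (others i j Y) ≡ f (b j) (b i) (others i j X)
    swapped f = trans (cong₂ (λ u v → f u v (others i j Y)) (swapAt-i b i j) (swapAt-j b i≢j))
      (cong (f (b j) (b i)) (sym (others-≡ bl bl′ (λ c c≢i c≢j → sym (swapAt-other b c c≢i c≢j)))))

  swap-length : length X ≡ length Y
  swap-length = begin
    length X                             ≡⟨ length-BeadList i≢j bl ⟩
    b i + (b j + length (others i j X))  ≡⟨ x∙yz≈y∙xz (b i) (b j) _ ⟩
    b j + (b i + length (others i j X))  ≡⟨ swapped (λ u v Z → u + (v + length Z)) ⟨
    _                                    ≡⟨ length-BeadList i≢j bl′ ⟨
    length Y                             ∎
    where open ≡-Reasoning

  swap-sum-< : b j < b i → sum X < sum Y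
  swap-sum-< bⱼ<bᵢ = begin-strict
    sum X                         ≡⟨ sum-BeadList i≢j bl ⟩
    runners (b i) (b j) Oₓ        <⟨ runner-sums-swap-< i<j bⱼ<bᵢ (sum Oₓ) ⟩
    runners (b j) (b i) Oₓ        ≡⟨ swapped runners ⟨
    _                             ≡⟨ sum-BeadList i≢j bl′ ⟨
    sum Y                         ∎
    where
    open ≤-Reasoning
    Oₓ : List ℕ
    Oₓ = others i j X
    runners : ℕ → ℕ → List ℕ → ℕ
    runners u v Z = sum (runner i u) + (sum (runner j v) + sum Z)

-- Abacus of a core

module _ {ℓ : ℕ} .{{_ : NonZero ℓ}} where

  abacus≡length-rod : ∀ la c → abacus ℓ la c ≡ length (rod c (betas la))
  abacus≡length-rod la c = cong (λ X → length (rod c X)) (structureNumbers≡betas la)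

  abacus≤length : ∀ la c → abacus ℓ la c ≤ length la
  abacus≤length la c = begin
    abacus ℓ la c              ≡⟨ abacus≡length-rod la c ⟩
    length (rod c (betas la))  ≤⟨ length-filter (rod? c) (betas la) ⟩
    length (betas la)          ≡⟨ length-betas la ⟩
    length la                  ∎
    where open ≤-Reasoning

  core⇒BeadList : ∀ {la} → IsPartition la → IsCore ℓ la → BeadList (abacus ℓ la) (betas la)
  core⇒BeadList {la} isP core = BeadList-cong (λ c → sym (abacus≡length-rod la c))
    (closed⇒BeadList (betas-decreasing (partition-decreasing isP)) (core⇒betas-closed isP core))

  core⇒rod₀-empty : ∀ {la} → IsPartition la → IsCore ℓ la → ∀ c → toℕ c ≡ 0 → abacus ℓ la c ≡ 0
  core⇒rod₀-empty {la} isP core c c≡0 = trans (abacus≡length-rod la c)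
    (cong length (filter-none (rod? c) (All.tabulate (λ x∈ x%≡ →
      core⇒betas-∤ isP core x∈ (m%n≡0⇒n∣m _ ℓ (trans x%≡ c≡0))))))

  module _ {b : Fin ℓ → ℕ} {L : List ℕ} (bl : BeadList b L) (pos : All (1 ≤_) L) where

    private
      >L : AllPairs _>_ L
      >L = BeadList.decreasing bl
      betas≡ : betas (fromBetas L) ≡ L
      betas≡ = betas-fromBetas >L pos

    fromBetas-isCore : IsCore ℓ (fromBetas L)
    fromBetas-isCore =
      IsCoreAt⇒IsCore {ℓ} {fromBetas L} (residue-closed⇒core >L pos (BeadList-residue-closed bl))

    abacus-fromBetas : ∀ c → abacus ℓ (fromBetas L) c ≡ b c
    abacus-fromBetas c = trans (abacus≡length-rod (fromBetas L) c)
      (trans (cong (λ X → length (rod c X)) betas≡) (length-rod-BeadList bl c))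

    size-fromBetas : size (fromBetas L) + sum (downFrom (length L)) ≡ sum L
    size-fromBetas = trans (cong (λ n → size (fromBetas L) + sum (downFrom n)) (sym (length-fromBetas L)))
      (trans (size-betas (fromBetas L)) (cong sum betas≡))

  swap-size-< : ∀ {la b L} {i j : Fin ℓ} → BeadList b (betas la) → BeadList (swapAt b i j) L → All (1 ≤_) L →
    toℕ i < toℕ j → b j < b i → size la < size (fromBetas L)
  swap-size-< {la} {L = L} blS blL pos i<j bⱼ<bᵢ = +-cancelʳ-< (sum (downFrom s)) _ _ (begin-strict
    size la + sum (downFrom s)                       ≡⟨ size-betas la ⟩
    sum (betas la)                                   <⟨ swap-sum-< blS blL i<j bⱼ<bᵢ ⟩
    sum L                                            ≡⟨ size-fromBetas blL pos ⟨
    size (fromBetas L) + sum (downFrom (length L))   ≡⟨ cong (λ n → size (fromBetas L) + sum (downFrom n)) length≡ ⟨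
    size (fromBetas L) + sum (downFrom s)            ∎)
    where
    open ≤-Reasoning
    s : ℕ
    s = length la
    length≡ : s ≡ length L
    length≡ = trans (sym (length-betas la)) (swap-length blS blL i<j)

lemma4p5 : (ℓ : ℕ) .{{_ : NonZero ℓ}} → Prime ℓ →
    (la : List ℕ) → IsPartition la → IsCore ℓ la →
    (i j : Fin ℓ) → 1 ≤ toℕ i → toℕ i < toℕ j →
    abacus ℓ la j < abacus ℓ la i →
    Σ (List ℕ) (λ mu → IsPartition mu × IsCore ℓ mu ×
      ((c : Fin ℓ) → abacus ℓ mu c ≡ swapAt (abacus ℓ la) i j c) ×
      size la < size mu)
lemma4p5 ℓ _ la isP core i j 1≤i i<j bⱼ<bᵢ =
  fromBetas L , fromBetas-isPartition (BeadList.decreasing blL) posL , fromBetas-isCore blL posL ,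
  abacus-fromBetas blL posL , swap-size-< (core⇒BeadList isP core) blL posL i<j bⱼ<bᵢ
  where
  b : Fin ℓ → ℕ
  b = abacus ℓ la
  L : List ℕ
  L = beads (length la) (swapAt b i j)
  blL : BeadList (swapAt b i j) L
  blL = beads-BeadList (swapAt-≤ (abacus≤length la) i j)
  rod₀≢ : ∀ {c d} → toℕ c ≡ 0 → 0 < toℕ d → c ≢ d
  rod₀≢ c≡0 0<d refl = <⇒≢ 0<d (sym c≡0)
  posL : All (1 ≤_) L
  posL = BeadList-positive blL (λ c c≡0 →
    trans (swapAt-other b c (rod₀≢ c≡0 1≤i) (rod₀≢ c≡0 (<-trans 1≤i i<j))) (core⇒rod₀-empty isP core c c≡0))
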